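{- Let $g(x)\in\mathbb F_q[x]$ and $c\in\mathbb F$ be such that $(a,x)\mapsto(a+g(x),x+c)$ defines an automorphism of $C_{R,\mathbb F}$. Then $E_R(c)=0$.
   Context: Let $p$ be an odd prime, $q=p^f$, $\mathbb F$ an algebraic closure of $\mathbb F_q$. Let $R(x)=\sum_{i=0}^e a_ix^{p^i}\in\mathbb F_q[x]$ with $a_e\neq0$, $E_R(x)=R(x)^{p^e}+\sum_{i=0}^e(a_ix)^{p^{e-i}}$, and $C_R$ the affine curve $a^p-a=xR(x)$ over $\mathbb F_q$, $C_{R,\mathbb F}$ its base change to $\mathbb F$. -}

module Defs where

open import Level using (Level; _⊔_)
open import Algebra.Bundles using (CommutativeRing)
open import Data.Nat as ℕ using (ℕ; zero; suc)
open import Data.Nat.Primality using (Prime)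
open import Data.Fin using (Fin; toℕ; fromℕ)
open import Data.Vec using (Vec; lookup)
open import Data.List using (List; []; _∷_)
open import Data.List.Relation.Unary.All using (All)
open import Data.Product using (Σ; _×_; ∃)
open import Relation.Nullary using (¬_)

module _ {c ℓ : Level} (F : CommutativeRing c ℓ) where
  open CommutativeRing F

  pow : Carrier → ℕ → Carrier
  pow x zero    = 1#
  pow x (suc n) = x * pow x n

  _−_ : Carrier → Carrier → Carrier
  x − y = x + (- y)

  natF : ℕ → Carrier
  natF zero    = 0#
  natF (suc n) = 1# + natF n

  ΣFin : (n : ℕ) → (Fin n → Carrier) → Carrier
  ΣFin zero    f = 0#
  ΣFin (suc n) f = f Fin.zero + ΣFin n (λ i → f (Fin.suc i))

  -- polynomial given by coefficient list [b0, b1, ...] (constant term first)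
  evalPoly : List Carrier → Carrier → Carrier
  evalPoly []       x = 0#
  evalPoly (b ∷ bs) x = b + x * evalPoly bs x

  evalMonic : (n : ℕ) → Vec Carrier (suc n) → Carrier → Carrier
  evalMonic n bs x = pow x (suc n) + ΣFin (suc n) (λ i → lookup bs i * pow x (toℕ i))

  record IsField : Set (c ⊔ ℓ) where
    field
      nontrivial : ¬ (1# ≈ 0#)
      inverse    : ∀ x → ¬ (x ≈ 0#) → Σ Carrier (λ y → x * y ≈ 1#)

  -- membership in the subfield F_q = { y | y^q = y }
  InFq : ℕ → Carrier → Set ℓ
  InFq q y = pow y q ≈ y

  record IsAlgClosureOfFq (p q : ℕ) : Set (c ⊔ ℓ) where
    field
      isField        : IsField
      characteristic : natF p ≈ 0#
      algClosed      : ∀ n (bs : Vec Carrier (suc n)) →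
                         Σ Carrier (λ x → evalMonic n bs x ≈ 0#)
      algebraic      : ∀ y → Σ ℕ (λ n → Σ (Vec Carrier (suc n)) (λ bs →
                         ((i : Fin (suc n)) → InFq q (lookup bs i)) ×
                         evalMonic n bs y ≈ 0#))

  evalR : (p e : ℕ) → Vec Carrier (suc e) → Carrier → Carrier
  evalR p e as x = ΣFin (suc e) (λ i → lookup as i * pow x (ℕ._^_ p (toℕ i)))

  evalE : (p e : ℕ) → Vec Carrier (suc e) → Carrier → Carrier
  evalE p e as x = pow (evalR p e as x) (ℕ._^_ p e)
                 + ΣFin (suc e) (λ i → pow (lookup as i * x) (ℕ._^_ p (ℕ._∸_ e (toℕ i))))

  OnC : (p e : ℕ) → Vec Carrier (suc e) → Carrier → Carrier → Set ℓ
  OnC p e as a x = pow a p − a ≈ x * evalR p e as x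

  -- (a,x) ↦ (a + g(x), x + c) is an automorphism of C_{R,F}: it maps C into C
  -- and is onto C (injectivity on F² is automatic).
  IsCurveAut : (p e : ℕ) → Vec Carrier (suc e) → List Carrier → Carrier → Set (c ⊔ ℓ)
  IsCurveAut p e as g cc =
    (∀ a x → OnC p e as a x → OnC p e as (a + evalPoly g x) (x + cc)) ×
    (∀ b y → OnC p e as b y → Σ Carrier (λ a → Σ Carrier (λ x →
        OnC p e as a x × ((b ≈ a + evalPoly g x) × (y ≈ x + cc)))))

-- Every x ∈ F lies under a point (a, x) of C_R, since F is algebraically closed. Applying the
-- automorphism and subtracting the curve equation, using that Frobenius and R are additive in
-- characteristic p, gives the identity G(x)ᵖ - G(x) = x R(c) + c R(x) + c R(c) of polynomial
-- functions, where G is the polynomial with coefficient list g. F is infinite, so coefficients may be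
-- compared: for tⱼ the coefficient of x^{pʲ} in G, the coefficients of x and x^{p^{j+1}} give
-- t₀ = -(R(c) + a₀c) and t_{j+1} = tⱼᵖ - a_{j+1}c, whence tₑ = -E_R(c). For j ≥ e the recursion reads
-- t_{j+1} = tⱼᵖ; as tₑ ∈ F_q it is fixed by high enough powers of Frobenius, and so equals some
-- t_{e+N} beyond the degree of G, which is 0.
module Submission where

open import Defs
open import Level using (Level; _⊔_)
open import Algebra.Bundles using (CommutativeRing)
open import Data.Nat using (ℕ; suc; _^_)
open import Data.Nat.Primality using (Prime)
open import Data.Fin using (Fin; fromℕ)
open import Data.Vec using (Vec; lookup)
open import Data.List using (List)
open import Data.List.Relation.Unary.All using (All)
open import Relation.Nullary using (¬_)
open import Relation.Binary.PropositionalEquality using (_≡_)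

open import Data.Nat as ℕ using (zero; _≤_; _<_; z≤n; s≤s; _∸_; _!)
import Data.Nat.Properties as ℕ
open import Data.Nat.Base using (nonTrivial⇒n>1; nonTrivial⇒≢1)
open import Data.Nat.Divisibility using (_∣_; _∤_; divides; ∣-refl; ∣⇒≤; ∣1⇒≡1; ∣m⇒∣m*n)
open import Data.Nat.DivMod using (m*[n/m]≡n)
open import Data.Nat.Primality using (euclidsLemma; prime⇒nonTrivial; prime⇒nonZero)
open import Data.Nat.Combinatorics using (_C_; nCn≡1; nCk≡n!/k![n-k]!; k![n∸k]!∣n!)
open import Data.Integer as ℤ using (ℤ; -[1+_]; _⊖_; _◃_; sign; ∣_∣)
import Data.Integer.Properties as ℤ
open import Data.Sign as Sign using (Sign)
open import Data.Fin as Fin using (toℕ)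
import Data.Vec as Vec
open import Data.Vec.Properties using (toList∘fromList; length-toList)
open import Data.List as List using ([]; _∷_; _++_; length; map; replicate)
import Data.List.Relation.Unary.All as All
open import Data.List.Relation.Unary.All using ([]; _∷_)
open import Data.List.Relation.Unary.All.Properties using (¬Any⇒All¬)
open import Data.List.Relation.Unary.Any using (Any; here; there)
open import Data.List.Relation.Unary.AllPairs using (AllPairs; []; _∷_)
open import Data.Maybe using (Maybe; just; nothing)
open import Data.Product using (Σ; _,_; proj₁; proj₂)
open import Data.Sum using (inj₁; inj₂)
open import Data.Empty using (⊥-elim)
open import Function using (_∘_)
open import Relation.Nullary using (Dec; yes; no)
open import Relation.Binary.Definitions using (tri<; tri≈; tri>)
open import Relation.Binary.PropositionalEquality using (_≢_)
import Relation.Binary.PropositionalEquality as ≡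
import Algebra.Properties.Semiring.Sum as Sum

prime∤! : ∀ {p n} → Prime p → n < p → p ∤ n !
prime∤! {n = zero}  pp _ p∣1 = nonTrivial⇒≢1 {{prime⇒nonTrivial pp}} (∣1⇒≡1 p∣1)
prime∤! {n = suc n} pp n<p p∣n! with euclidsLemma (suc n) (n !) pp p∣n!
... | inj₁ p∣1+n = ℕ.<⇒≱ n<p (∣⇒≤ p∣1+n)
... | inj₂ p∣n!  = prime∤! pp (ℕ.<-trans (ℕ.n<1+n n) n<p) p∣n!

prime⇒2≤ : ∀ {p} → Prime p → 2 ≤ p
prime⇒2≤ {p} pp = nonTrivial⇒n>1 p {{prime⇒nonTrivial pp}}

n∣n! : ∀ n → .{{ℕ.NonZero n}} → n ∣ n !
n∣n! (suc n) = ∣m⇒∣m*n (n !) ∣-refl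

k![n∸k]!*nCk≡n! : ∀ {n k} → k ≤ n → (k ! ℕ.* (n ∸ k) !) ℕ.* (n C k) ≡ n !
k![n∸k]!*nCk≡n! {n} {k} k≤n =
  ≡.trans (≡.cong (k ! ℕ.* (n ∸ k) ! ℕ.*_) (nCk≡n!/k![n-k]! k≤n)) (m*[n/m]≡n (k![n∸k]!∣n! k≤n))
  where instance _ = k ℕ.!* (n ∸ k) !≢0

prime∣binomial : ∀ {p k} → Prime p → 0 < k → k < p → p ∣ p C k
prime∣binomial {p} {k} pp 0<k k<p
  with euclidsLemma (k ! ℕ.* (p ∸ k) !) (p C k) pp
         (≡.subst (p ∣_) (≡.sym (k![n∸k]!*nCk≡n! (ℕ.<⇒≤ k<p))) (n∣n! p {{prime⇒nonZero pp}}))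
... | inj₂ p∣pCk = p∣pCk
... | inj₁ p∣k![p-k]! with euclidsLemma (k !) ((p ∸ k) !) pp p∣k![p-k]!
...   | inj₁ p∣k! = ⊥-elim (prime∤! pp k<p p∣k!)
...   | inj₂ p∣[p-k]! = ⊥-elim (prime∤! pp (ℕ.∸-monoʳ-< 0<k (ℕ.<⇒≤ k<p)) p∣[p-k]!)

^-injectiveʳ : ∀ {m} → 1 < m → ∀ {i k} → m ^ i ≡ m ^ k → i ≡ k
^-injectiveʳ {m} 1<m {i} {k} mⁱ≡mᵏ with ℕ.<-cmp i k
... | tri< i<k _   _   = ⊥-elim (ℕ.<⇒≢ (ℕ.^-monoʳ-< m 1<m i<k) mⁱ≡mᵏ)
... | tri≈ _   i≡k _   = i≡k
... | tri> _   _   k<i = ⊥-elim (ℕ.<⇒≢ (ℕ.^-monoʳ-< m 1<m k<i) (≡.sym mⁱ≡mᵏ))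

n<m^n : ∀ {m} → 1 < m → ∀ n → n < m ^ n
n<m^n 1<m zero    = s≤s z≤n
n<m^n 1<m (suc n) = ℕ.≤-trans (s≤s (n<m^n 1<m n)) (ℕ.^-monoʳ-< _ 1<m (ℕ.n<1+n n))

-- The ring solver, with coefficients mapped in along ℤ → F: it can only cancel terms such as
-- x - x if its coefficient equality is decidable, which fails for the elements of F itself.
module IntegerSolver {c ℓ : Level} (F : CommutativeRing c ℓ) where
  open CommutativeRing F
  open import Algebra.Solver.Ring.AlmostCommutativeRing
    using (fromCommutativeRing; _-Raw-AlmostCommutative⟶_)
  open import Algebra.Properties.Semiring.Mult semiring using (_×_; ×-homo-+; ×1-homo-*)
  open import Algebra.Properties.Ring ring using (-0#≈0#; -‿involutive; -1*x≈-x; -‿+-comm)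
  open import Algebra.Properties.CommutativeSemigroup +-commutativeSemigroup
    using () renaming (interchange to +-interchange)
  open import Algebra.Properties.CommutativeSemigroup *-commutativeSemigroup
    using () renaming (interchange to *-interchange)
  open import Relation.Binary.Reasoning.Setoid setoid

  ⟦_⟧ : ℤ → Carrier
  ⟦ ℤ.+ n ⟧    = n × 1#
  ⟦ -[1+ n ] ⟧ = - (suc n × 1#)

  ⟦_⟧ˢ : Sign → Carrier
  ⟦ Sign.+ ⟧ˢ = 1#
  ⟦ Sign.- ⟧ˢ = - 1#

  [1+x]-[1+y]≈x-y : ∀ x y → (1# + x) - (1# + y) ≈ x - y
  [1+x]-[1+y]≈x-y x y = begin
    (1# + x) + - (1# + y)   ≈⟨ +-congˡ (-‿+-comm 1# y) ⟨
    (1# + x) + (- 1# + - y) ≈⟨ +-interchange 1# x (- 1#) (- y) ⟩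
    (1# - 1#) + (x - y)     ≈⟨ +-congʳ (-‿inverseʳ 1#) ⟩
    0# + (x - y)            ≈⟨ +-identityˡ _ ⟩
    x - y                   ∎

  ⊖-homo : ∀ m n → ⟦ m ⊖ n ⟧ ≈ m × 1# - n × 1#
  ⊖-homo zero    zero    = sym (-‿inverseʳ 0#)
  ⊖-homo zero    (suc n) = sym (+-identityˡ _)
  ⊖-homo (suc m) zero    = sym (trans (+-congˡ -0#≈0#) (+-identityʳ _))
  ⊖-homo (suc m) (suc n) = begin
    ⟦ suc m ⊖ suc n ⟧          ≡⟨ ≡.cong ⟦_⟧ (ℤ.[1+m]⊖[1+n]≡m⊖n m n) ⟩
    ⟦ m ⊖ n ⟧                  ≈⟨ ⊖-homo m n ⟩
    m × 1# - n × 1#            ≈⟨ [1+x]-[1+y]≈x-y (m × 1#) (n × 1#) ⟨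
    suc m × 1# - suc n × 1#    ∎

  +-homo : ∀ i j → ⟦ i ℤ.+ j ⟧ ≈ ⟦ i ⟧ + ⟦ j ⟧
  +-homo -[1+ m ] -[1+ n ] = begin
    - (suc (suc (m ℕ.+ n)) × 1#)       ≡⟨ ≡.cong (λ k → - (suc k × 1#)) (ℕ.+-suc m n) ⟨
    - (suc m ℕ.+ suc n) × 1#           ≈⟨ -‿cong (×-homo-+ 1# (suc m) (suc n)) ⟩
    - (suc m × 1# + suc n × 1#)        ≈⟨ -‿+-comm _ _ ⟨
    - (suc m × 1#) + - (suc n × 1#)    ∎
  +-homo -[1+ m ] (ℤ.+ n)    = trans (⊖-homo n (suc m)) (+-comm _ _)
  +-homo (ℤ.+ m)    -[1+ n ] = ⊖-homo m (suc n)
  +-homo (ℤ.+ m)    (ℤ.+ n)    = ×-homo-+ 1# m n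

  -‿homo : ∀ i → ⟦ ℤ.- i ⟧ ≈ - ⟦ i ⟧
  -‿homo -[1+ n ]    = sym (-‿involutive _)
  -‿homo (ℤ.+ zero)    = sym -0#≈0#
  -‿homo (ℤ.+ suc n)   = refl

  ◃-homo : ∀ s n → ⟦ s ◃ n ⟧ ≈ ⟦ s ⟧ˢ * n × 1#
  ◃-homo Sign.+ n = trans (reflexive (≡.cong ⟦_⟧ (ℤ.+◃n≡+n n))) (sym (*-identityˡ _))
  ◃-homo Sign.- n = begin
    ⟦ Sign.- ◃ n ⟧   ≡⟨ ≡.cong ⟦_⟧ (ℤ.-◃n≡-n n) ⟩
    ⟦ ℤ.- (ℤ.+ n) ⟧    ≈⟨ -‿homo (ℤ.+ n) ⟩
    - (n × 1#)       ≈⟨ -1*x≈-x (n × 1#) ⟨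
    - 1# * n × 1#    ∎

  *-homoˢ : ∀ s t → ⟦ s Sign.* t ⟧ˢ ≈ ⟦ s ⟧ˢ * ⟦ t ⟧ˢ
  *-homoˢ Sign.- Sign.- = sym (trans (-1*x≈-x (- 1#)) (-‿involutive 1#))
  *-homoˢ Sign.- Sign.+ = sym (*-identityʳ _)
  *-homoˢ Sign.+ Sign.- = sym (*-identityˡ _)
  *-homoˢ Sign.+ Sign.+ = sym (*-identityˡ _)

  ⟦⟧-sign-abs : ∀ i → ⟦ i ⟧ ≈ ⟦ sign i ⟧ˢ * ∣ i ∣ × 1#
  ⟦⟧-sign-abs i = trans (reflexive (≡.cong ⟦_⟧ (≡.sym (ℤ.◃-inverse i)))) (◃-homo (sign i) ∣ i ∣)

  *-homo : ∀ i j → ⟦ i ℤ.* j ⟧ ≈ ⟦ i ⟧ * ⟦ j ⟧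
  *-homo i j = begin
    ⟦ sign i Sign.* sign j ◃ ∣ i ∣ ℕ.* ∣ j ∣ ⟧
      ≈⟨ ◃-homo (sign i Sign.* sign j) (∣ i ∣ ℕ.* ∣ j ∣) ⟩
    ⟦ sign i Sign.* sign j ⟧ˢ * (∣ i ∣ ℕ.* ∣ j ∣) × 1#
      ≈⟨ *-cong (*-homoˢ (sign i) (sign j)) (×1-homo-* ∣ i ∣ ∣ j ∣) ⟩
    (⟦ sign i ⟧ˢ * ⟦ sign j ⟧ˢ) * (∣ i ∣ × 1# * ∣ j ∣ × 1#)
      ≈⟨ *-interchange _ _ _ _ ⟩
    (⟦ sign i ⟧ˢ * ∣ i ∣ × 1#) * (⟦ sign j ⟧ˢ * ∣ j ∣ × 1#)
      ≈⟨ *-cong (⟦⟧-sign-abs i) (⟦⟧-sign-abs j) ⟨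
    ⟦ i ⟧ * ⟦ j ⟧ ∎

  homomorphism : ℤ.+-*-rawRing -Raw-AlmostCommutative⟶ fromCommutativeRing F
  homomorphism = record
    { ⟦_⟧ = ⟦_⟧ ; +-homo = +-homo ; *-homo = *-homo ; -‿homo = -‿homo
    ; 0-homo = refl ; 1-homo = +-identityʳ 1# }

  ⟦⟧-≟ : ∀ i j → Maybe (⟦ i ⟧ ≈ ⟦ j ⟧)
  ⟦⟧-≟ i j with i ℤ.≟ j
  ... | yes ≡.refl = just refl
  ... | no _       = nothing

  open import Algebra.Solver.Ring ℤ.+-*-rawRing (fromCommutativeRing F) homomorphism ⟦⟧-≟ public
    using (solve; _:=_; _:+_; _:*_; :-_; _:-_)

module _ {c ℓ : Level} (F : CommutativeRing c ℓ) where
  open CommutativeRing F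
  open IntegerSolver F using (solve; _:=_; _:+_; _:*_; :-_; _:-_)
  open import Relation.Binary.Reasoning.Setoid setoid
  open import Algebra.Properties.Semiring.Exp semiring using () renaming (_^_ to _^ˢ_)
  open import Algebra.Properties.Ring ring
    using (-0#≈0#; -‿+-comm; -‿distribʳ-*; x≈y⇒x∙y⁻¹≈ε; x∙y⁻¹≈ε⇒x≈y)
  open import Algebra.Properties.CommutativeSemigroup +-commutativeSemigroup
    using () renaming (interchange to +-interchange)
  open import Algebra.Properties.CommutativeSemigroup *-commutativeSemigroup
    using () renaming (interchange to *-interchange)

  _^ᴿ_ : Carrier → ℕ → Carrier
  x ^ᴿ n = pow F x n

  infixr 8 _^ᴿ_

  ^ᴿ-congˡ : ∀ {x y} n → x ≈ y → x ^ᴿ n ≈ y ^ᴿ n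
  ^ᴿ-congˡ zero    _   = refl
  ^ᴿ-congˡ (suc n) x≈y = *-cong x≈y (^ᴿ-congˡ n x≈y)

  ^ᴿ-homo-* : ∀ x m n → x ^ᴿ (m ℕ.+ n) ≈ x ^ᴿ m * x ^ᴿ n
  ^ᴿ-homo-* x zero    n = sym (*-identityˡ _)
  ^ᴿ-homo-* x (suc m) n = trans (*-congˡ (^ᴿ-homo-* x m n)) (sym (*-assoc _ _ _))

  ^ᴿ-assocʳ : ∀ x m n → (x ^ᴿ m) ^ᴿ n ≈ x ^ᴿ (m ℕ.* n)
  ^ᴿ-assocʳ x m zero    = reflexive (≡.cong (x ^ᴿ_) (≡.sym (ℕ.*-zeroʳ m)))
  ^ᴿ-assocʳ x m (suc n) = begin
    x ^ᴿ m * (x ^ᴿ m) ^ᴿ n      ≈⟨ *-congˡ (^ᴿ-assocʳ x m n) ⟩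
    x ^ᴿ m * x ^ᴿ (m ℕ.* n)    ≈⟨ ^ᴿ-homo-* x m (m ℕ.* n) ⟨
    x ^ᴿ (m ℕ.+ m ℕ.* n)       ≡⟨ ≡.cong (x ^ᴿ_) (ℕ.*-suc m n) ⟨
    x ^ᴿ (m ℕ.* suc n)         ∎

  ^ᴿ-distrib-* : ∀ x y n → (x * y) ^ᴿ n ≈ x ^ᴿ n * y ^ᴿ n
  ^ᴿ-distrib-* x y zero    = sym (*-identityˡ 1#)
  ^ᴿ-distrib-* x y (suc n) = trans (*-congˡ (^ᴿ-distrib-* x y n)) (*-interchange x y _ _)

  x^ᴿ1≈x : ∀ x → x ^ᴿ 1 ≈ x
  x^ᴿ1≈x = *-identityʳ

  ^ᴿ-fixed-iter : ∀ {q y} → y ^ᴿ q ≈ y → ∀ K → y ^ᴿ (q ^ K) ≈ y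
  ^ᴿ-fixed-iter         y^q≈y zero    = x^ᴿ1≈x _
  ^ᴿ-fixed-iter {q} {y} y^q≈y (suc K) = begin
    y ^ᴿ (q ℕ.* q ^ K)     ≈⟨ ^ᴿ-assocʳ y q (q ^ K) ⟨
    (y ^ᴿ q) ^ᴿ (q ^ K)    ≈⟨ ^ᴿ-congˡ (q ^ K) y^q≈y ⟩
    y ^ᴿ (q ^ K)           ≈⟨ ^ᴿ-fixed-iter y^q≈y K ⟩
    y                      ∎

  ^ᴿ-^-suc : ∀ x m k → (x ^ᴿ (m ^ k)) ^ᴿ m ≈ x ^ᴿ (m ^ suc k)
  ^ᴿ-^-suc x m k = trans (^ᴿ-assocʳ x (m ^ k) m) (reflexive (≡.cong (x ^ᴿ_) (ℕ.*-comm (m ^ k) m)))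

  0^ᴿn≈0 : ∀ n .{{_ : ℕ.NonZero n}} → 0# ^ᴿ n ≈ 0#
  0^ᴿn≈0 (suc n) = zeroˡ _

  ^ᴿ≡^ : ∀ x n → x ^ᴿ n ≡ x ^ˢ n
  ^ᴿ≡^ x zero    = ≡.refl
  ^ᴿ≡^ x (suc n) = ≡.cong (x *_) (^ᴿ≡^ x n)

  sumBelow : ℕ → (ℕ → Carrier) → Carrier
  sumBelow zero    f = 0#
  sumBelow (suc n) f = f 0 + sumBelow n (f ∘ suc)

  ΣFin≡sumBelow : ∀ n f → ΣFin F n (f ∘ toℕ) ≡ sumBelow n f
  ΣFin≡sumBelow zero    f = ≡.refl
  ΣFin≡sumBelow (suc n) f = ≡.cong (f 0 +_) (ΣFin≡sumBelow n (f ∘ suc))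

  sum≡sumBelow : ∀ n f → Sum.sum semiring {n} (f ∘ toℕ) ≡ sumBelow n f
  sum≡sumBelow zero    f = ≡.refl
  sum≡sumBelow (suc n) f = ≡.cong (f 0 +_) (sum≡sumBelow n (f ∘ suc))

  sumBelow-cong : ∀ n (f g : ℕ → Carrier) → (∀ i → i < n → f i ≈ g i) → sumBelow n f ≈ sumBelow n g
  sumBelow-cong zero    f g _   = refl
  sumBelow-cong (suc n) f g f≈g =
    +-cong (f≈g 0 (s≤s z≤n)) (sumBelow-cong n (f ∘ suc) (g ∘ suc) (λ i i<n → f≈g (suc i) (s≤s i<n)))

  sumBelow-zero : ∀ n (f : ℕ → Carrier) → (∀ i → i < n → f i ≈ 0#) → sumBelow n f ≈ 0#
  sumBelow-zero zero    f _   = refl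
  sumBelow-zero (suc n) f f≈0 =
    trans (+-cong (f≈0 0 (s≤s z≤n)) (sumBelow-zero n (f ∘ suc) (λ i i<n → f≈0 (suc i) (s≤s i<n))))
          (+-identityˡ 0#)

  sumBelow-distrib-+ : ∀ n (f g : ℕ → Carrier) →
                       sumBelow n (λ i → f i + g i) ≈ sumBelow n f + sumBelow n g
  sumBelow-distrib-+ zero    f g = sym (+-identityˡ 0#)
  sumBelow-distrib-+ (suc n) f g =
    trans (+-congˡ (sumBelow-distrib-+ n (f ∘ suc) (g ∘ suc))) (+-interchange (f 0) (g 0) _ _)

  *-distribˡ-sumBelow : ∀ n x (f : ℕ → Carrier) → sumBelow n (λ i → x * f i) ≈ x * sumBelow n f
  *-distribˡ-sumBelow zero    x f = sym (zeroʳ x)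
  *-distribˡ-sumBelow (suc n) x f = trans (+-congˡ (*-distribˡ-sumBelow n x (f ∘ suc))) (sym (distribˡ x _ _))

  sumBelow-last : ∀ n (f : ℕ → Carrier) → sumBelow (suc n) f ≈ sumBelow n f + f n
  sumBelow-last zero    f = trans (+-identityʳ (f 0)) (sym (+-identityˡ (f 0)))
  sumBelow-last (suc n) f = trans (+-congˡ (sumBelow-last n (f ∘ suc))) (sym (+-assoc _ _ _))

  sumBelow-single : ∀ n j (f : ℕ → Carrier) → j < n → (∀ i → i < n → i ≢ j → f i ≈ 0#) →
                    sumBelow n f ≈ f j
  sumBelow-single (suc n) zero    f _         f≈0 =
    trans (+-congˡ (sumBelow-zero n (f ∘ suc) (λ i i<n → f≈0 (suc i) (s≤s i<n) λ ()))) (+-identityʳ _)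
  sumBelow-single (suc n) (suc j) f (s≤s j<n) f≈0 =
    trans (+-cong (f≈0 0 (s≤s z≤n) λ ())
                  (sumBelow-single n j (f ∘ suc) j<n λ i i<n i≢j →
                     f≈0 (suc i) (s≤s i<n) (i≢j ∘ ℕ.suc-injective)))
          (+-identityˡ _)

  sumBelow-ends : ∀ n (f : ℕ → Carrier) → 0 < n → (∀ i → 0 < i → i < n → f i ≈ 0#) →
                  sumBelow (suc n) f ≈ f 0 + f n
  sumBelow-ends (suc m) f _ interior≈0 = +-congˡ (begin
    sumBelow (suc m) (f ∘ suc)          ≈⟨ sumBelow-last m (f ∘ suc) ⟩
    sumBelow m (f ∘ suc) + f (suc m)    ≈⟨ +-congʳ (sumBelow-zero m (f ∘ suc) interior) ⟩
    0# + f (suc m)                      ≈⟨ +-identityˡ _ ⟩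
    f (suc m)                           ∎)
    where
    interior : ∀ i → i < m → f (suc i) ≈ 0#
    interior i i<m = interior≈0 (suc i) (s≤s z≤n) (s≤s i<m)

  -- Polynomials as coefficient lists

  coeff : List Carrier → ℕ → Carrier
  coeff []       _       = 0#
  coeff (b ∷ bs) zero    = b
  coeff (b ∷ bs) (suc n) = coeff bs n

  coeff-beyond : ∀ bs {n} → length bs ≤ n → coeff bs n ≡ 0#
  coeff-beyond []       _         = ≡.refl
  coeff-beyond (b ∷ bs) (s≤s len≤n) = coeff-beyond bs len≤n

  coeff-All : ∀ {P : Carrier → Set ℓ} → P 0# → ∀ {bs} → All P bs → ∀ n → P (coeff bs n)
  coeff-All P0 []         _       = P0
  coeff-All P0 (Pb ∷ Pbs) zero    = Pb
  coeff-All P0 (Pb ∷ Pbs) (suc n) = coeff-All P0 Pbs n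

  coeff-map : ∀ (f : Carrier → Carrier) → f 0# ≈ 0# → ∀ bs n → coeff (map f bs) n ≈ f (coeff bs n)
  coeff-map f f0≈0 []       n       = sym f0≈0
  coeff-map f f0≈0 (b ∷ bs) zero    = refl
  coeff-map f f0≈0 (b ∷ bs) (suc n) = coeff-map f f0≈0 bs n

  evalPoly-zeros : ∀ {bs} x → All (_≈ 0#) bs → evalPoly F bs x ≈ 0#
  evalPoly-zeros x []           = refl
  evalPoly-zeros x (b≈0 ∷ bs≈0) =
    trans (+-cong b≈0 (trans (*-congˡ (evalPoly-zeros x bs≈0)) (zeroʳ x))) (+-identityʳ 0#)

  infixl 6 _⊕_

  _⊕_ : List Carrier → List Carrier → List Carrier
  []       ⊕ cs       = cs
  (b ∷ bs) ⊕ []       = b ∷ bs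
  (b ∷ bs) ⊕ (c ∷ cs) = b + c ∷ bs ⊕ cs

  evalPoly-⊕ : ∀ bs cs x → evalPoly F (bs ⊕ cs) x ≈ evalPoly F bs x + evalPoly F cs x
  evalPoly-⊕ []       cs       x = sym (+-identityˡ _)
  evalPoly-⊕ (b ∷ bs) []       x = sym (+-identityʳ _)
  evalPoly-⊕ (b ∷ bs) (c ∷ cs) x = begin
    (b + c) + x * evalPoly F (bs ⊕ cs) x                          ≈⟨ +-congˡ (*-congˡ (evalPoly-⊕ bs cs x)) ⟩
    (b + c) + x * (evalPoly F bs x + evalPoly F cs x)             ≈⟨ +-congˡ (distribˡ x _ _) ⟩
    (b + c) + (x * evalPoly F bs x + x * evalPoly F cs x)         ≈⟨ +-interchange b c _ _ ⟩
    (b + x * evalPoly F bs x) + (c + x * evalPoly F cs x)         ∎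

  coeff-⊕ : ∀ bs cs n → coeff (bs ⊕ cs) n ≈ coeff bs n + coeff cs n
  coeff-⊕ []       cs       n       = sym (+-identityˡ _)
  coeff-⊕ (b ∷ bs) []       n       = sym (+-identityʳ _)
  coeff-⊕ (b ∷ bs) (c ∷ cs) zero    = refl
  coeff-⊕ (b ∷ bs) (c ∷ cs) (suc n) = coeff-⊕ bs cs n

  evalPoly-neg : ∀ bs x → evalPoly F (map -_ bs) x ≈ - evalPoly F bs x
  evalPoly-neg []       x = sym -0#≈0#
  evalPoly-neg (b ∷ bs) x = begin
    - b + x * evalPoly F (map -_ bs) x   ≈⟨ +-congˡ (*-congˡ (evalPoly-neg bs x)) ⟩
    - b + x * - evalPoly F bs x          ≈⟨ +-congˡ (-‿distribʳ-* x _) ⟨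
    - b + - (x * evalPoly F bs x)        ≈⟨ -‿+-comm b _ ⟩
    - (b + x * evalPoly F bs x)          ∎

  mulXPow : ℕ → List Carrier → List Carrier
  mulXPow k bs = replicate k 0# ++ bs

  evalPoly-mulXPow : ∀ k bs x → evalPoly F (mulXPow k bs) x ≈ x ^ᴿ k * evalPoly F bs x
  evalPoly-mulXPow zero    bs x = sym (*-identityˡ _)
  evalPoly-mulXPow (suc k) bs x = begin
    0# + x * evalPoly F (mulXPow k bs) x    ≈⟨ +-identityˡ _ ⟩
    x * evalPoly F (mulXPow k bs) x         ≈⟨ *-congˡ (evalPoly-mulXPow k bs x) ⟩
    x * (x ^ᴿ k * evalPoly F bs x)        ≈⟨ *-assoc x _ _ ⟨
    x ^ᴿ suc k * evalPoly F bs x          ∎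

  coeff-mulXPow : ∀ k bs n → coeff (mulXPow k bs) (k ℕ.+ n) ≡ coeff bs n
  coeff-mulXPow zero    bs n = ≡.refl
  coeff-mulXPow (suc k) bs n = coeff-mulXPow k bs n

  monomial : ℕ → Carrier → List Carrier
  monomial n b = mulXPow n (b ∷ [])

  evalPoly-monomial : ∀ n b x → evalPoly F (monomial n b) x ≈ b * x ^ᴿ n
  evalPoly-monomial n b x = begin
    evalPoly F (monomial n b) x    ≈⟨ evalPoly-mulXPow n (b ∷ []) x ⟩
    x ^ᴿ n * (b + x * 0#)          ≈⟨ *-congˡ (trans (+-congˡ (zeroʳ x)) (+-identityʳ b)) ⟩
    x ^ᴿ n * b                     ≈⟨ *-comm _ b ⟩
    b * x ^ᴿ n                     ∎

  coeff-monomial-≡ : ∀ n b → coeff (monomial n b) n ≡ b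
  coeff-monomial-≡ zero    b = ≡.refl
  coeff-monomial-≡ (suc n) b = coeff-monomial-≡ n b

  coeff-monomial-≢ : ∀ n b {m} → m ≢ n → coeff (monomial n b) m ≈ 0#
  coeff-monomial-≢ zero    b {zero}  m≢n = ⊥-elim (m≢n ≡.refl)
  coeff-monomial-≢ zero    b {suc m} m≢n = refl
  coeff-monomial-≢ (suc n) b {zero}  m≢n = refl
  coeff-monomial-≢ (suc n) b {suc m} m≢n = coeff-monomial-≢ n b (m≢n ∘ ≡.cong suc)

  spread : ℕ → List Carrier → List Carrier
  spread n []       = []
  spread n (b ∷ bs) = b ∷ mulXPow (ℕ.pred n) (spread n bs)

  evalPoly-spread : ∀ n .{{_ : ℕ.NonZero n}} bs x → evalPoly F (spread n bs) x ≈ evalPoly F bs (x ^ᴿ n)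
  evalPoly-spread n@(suc k) []       x = refl
  evalPoly-spread n@(suc k) (b ∷ bs) x = +-congˡ (begin
    x * evalPoly F (mulXPow k (spread n bs)) x    ≈⟨ *-congˡ (evalPoly-mulXPow k _ x) ⟩
    x * (x ^ᴿ k * evalPoly F (spread n bs) x)   ≈⟨ *-assoc x _ _ ⟨
    x ^ᴿ n * evalPoly F (spread n bs) x         ≈⟨ *-congˡ (evalPoly-spread n bs x) ⟩
    x ^ᴿ n * evalPoly F bs (x ^ᴿ n)             ∎)

  coeff-spread : ∀ n .{{_ : ℕ.NonZero n}} bs i → coeff (spread n bs) (i ℕ.* n) ≡ coeff bs i
  coeff-spread n       []       i       = ≡.refl
  coeff-spread n       (b ∷ bs) zero    = ≡.refl
  coeff-spread (suc k) (b ∷ bs) (suc i) = ≡.trans (coeff-mulXPow k _ (i ℕ.* suc k)) (coeff-spread (suc k) bs i)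

  coeff-spread-1 : ∀ n bs → 2 ≤ n → coeff (spread n bs) 1 ≡ 0#
  coeff-spread-1 n             []       _           = ≡.refl
  coeff-spread-1 (suc (suc k)) (b ∷ bs) (s≤s (s≤s _)) = ≡.refl

  sumᴾ : ℕ → (ℕ → List Carrier) → List Carrier
  sumᴾ zero    P = []
  sumᴾ (suc n) P = P 0 ⊕ sumᴾ n (P ∘ suc)

  evalPoly-sumᴾ : ∀ n P x → evalPoly F (sumᴾ n P) x ≈ sumBelow n (λ i → evalPoly F (P i) x)
  evalPoly-sumᴾ zero    P x = refl
  evalPoly-sumᴾ (suc n) P x = trans (evalPoly-⊕ (P 0) _ x) (+-congˡ (evalPoly-sumᴾ n (P ∘ suc) x))

  coeff-sumᴾ : ∀ n P k → coeff (sumᴾ n P) k ≈ sumBelow n (λ i → coeff (P i) k)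
  coeff-sumᴾ zero    P k = refl
  coeff-sumᴾ (suc n) P k = trans (coeff-⊕ (P 0) _ k) (+-congˡ (coeff-sumᴾ n (P ∘ suc) k))

  ΣFin-cong : ∀ n {f g : Fin n → Carrier} → (∀ i → f i ≈ g i) → ΣFin F n f ≈ ΣFin F n g
  ΣFin-cong zero    _   = refl
  ΣFin-cong (suc n) f≈g = +-cong (f≈g Fin.zero) (ΣFin-cong n (f≈g ∘ Fin.suc))

  lookup≡coeff : ∀ {n} (v : Vec Carrier n) i → lookup v i ≡ coeff (Vec.toList v) (toℕ i)
  lookup≡coeff (b Vec.∷ v) Fin.zero    = ≡.refl
  lookup≡coeff (b Vec.∷ v) (Fin.suc i) = lookup≡coeff v i

  evalMonicList : List Carrier → Carrier → Carrier
  evalMonicList []       x = 1#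
  evalMonicList (c ∷ cs) x = c + x * evalMonicList cs x

  evalMonicList-zeros : ∀ m y → evalMonicList (replicate m 0#) y ≈ y ^ᴿ m
  evalMonicList-zeros zero    y = refl
  evalMonicList-zeros (suc m) y = trans (+-identityˡ _) (*-congˡ (evalMonicList-zeros m y))

  sumBelow-coeff+top≈evalMonicList : ∀ cs x →
    sumBelow (length cs) (λ i → coeff cs i * x ^ᴿ i) + x ^ᴿ length cs ≈ evalMonicList cs x
  sumBelow-coeff+top≈evalMonicList []       x = +-identityˡ 1#
  sumBelow-coeff+top≈evalMonicList (c ∷ cs) x = begin
    (c * 1# + sumBelow n (λ i → coeff cs i * (x * x ^ᴿ i))) + x * x ^ᴿ n
      ≈⟨ +-congʳ (+-cong (*-identityʳ c) (sumBelow-cong n _ _ (λ i _ → x∙yz≈y∙xz _ x _))) ⟩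
    (c + sumBelow n (λ i → x * (coeff cs i * x ^ᴿ i))) + x * x ^ᴿ n
      ≈⟨ +-congʳ (+-congˡ (*-distribˡ-sumBelow n x _)) ⟩
    (c + x * S) + x * x ^ᴿ n
      ≈⟨ +-assoc c _ _ ⟩
    c + (x * S + x * x ^ᴿ n)
      ≈⟨ +-congˡ (distribˡ x S _) ⟨
    c + x * (S + x ^ᴿ n)
      ≈⟨ +-congˡ (*-congˡ (sumBelow-coeff+top≈evalMonicList cs x)) ⟩
    c + x * evalMonicList cs x ∎
    where
    n = length cs
    S = sumBelow n (λ i → coeff cs i * x ^ᴿ i)
    open import Algebra.Properties.CommutativeSemigroup *-commutativeSemigroup using (x∙yz≈y∙xz)

  evalMonic-fromList : ∀ c cs x →
    evalMonic F (length cs) (Vec.fromList (c ∷ cs)) x ≈ evalMonicList (c ∷ cs) x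
  evalMonic-fromList c cs x = begin
    x ^ᴿ suc n + ΣFin F (suc n) (λ i → lookup (Vec.fromList (c ∷ cs)) i * x ^ᴿ toℕ i)
      ≈⟨ +-comm _ _ ⟩
    ΣFin F (suc n) (λ i → lookup (Vec.fromList (c ∷ cs)) i * x ^ᴿ toℕ i) + x ^ᴿ suc n
      ≈⟨ +-congʳ (ΣFin-cong (suc n) λ i → *-congʳ {x ^ᴿ toℕ i} (reflexive (lookup≡coeff-fromList i))) ⟩
    ΣFin F (suc n) (λ i → coeff (c ∷ cs) (toℕ i) * x ^ᴿ toℕ i) + x ^ᴿ suc n
      ≡⟨ ≡.cong (_+ x ^ᴿ suc n) (ΣFin≡sumBelow (suc n) (λ i → coeff (c ∷ cs) i * x ^ᴿ i)) ⟩
    sumBelow (suc n) (λ i → coeff (c ∷ cs) i * x ^ᴿ i) + x ^ᴿ suc n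
      ≈⟨ sumBelow-coeff+top≈evalMonicList (c ∷ cs) x ⟩
    evalMonicList (c ∷ cs) x ∎
    where
    n = length cs
    lookup≡coeff-fromList : ∀ i → lookup (Vec.fromList (c ∷ cs)) i ≡ coeff (c ∷ cs) (toℕ i)
    lookup≡coeff-fromList i =
      ≡.trans (lookup≡coeff (Vec.fromList (c ∷ cs)) i)
              (≡.cong (λ bs → coeff bs (toℕ i)) (toList∘fromList (c ∷ cs)))

  AlgebraicallyClosed : Set (c ⊔ ℓ)
  AlgebraicallyClosed = ∀ n (bs : Vec Carrier (suc n)) → Σ Carrier (λ x → evalMonic F n bs x ≈ 0#)

  rootOfMonic : AlgebraicallyClosed → ∀ c cs → Σ Carrier (λ y → evalMonicList (c ∷ cs) y ≈ 0#)
  rootOfMonic closed c cs with closed (length cs) (Vec.fromList (c ∷ cs))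
  ... | y , root = y , trans (sym (evalMonic-fromList c cs y)) root

  -- The identity theorem for polynomials

  differenceQuotient : Carrier → List Carrier → List Carrier
  differenceQuotient a []       = []
  differenceQuotient a (c ∷ cs) = evalPoly F (c ∷ cs) a ∷ differenceQuotient a cs

  length-differenceQuotient : ∀ a cs → length (differenceQuotient a cs) ≡ length cs
  length-differenceQuotient a []       = ≡.refl
  length-differenceQuotient a (c ∷ cs) = ≡.cong suc (length-differenceQuotient a cs)

  evalPoly-differenceQuotient : ∀ b bs z a →
    evalPoly F (b ∷ bs) z - evalPoly F (b ∷ bs) a ≈ (z - a) * evalPoly F (differenceQuotient a bs) z
  evalPoly-differenceQuotient b [] z a =
    solve 4 (λ b z a w → (b :+ z :* w) :- (b :+ a :* w) := (z :- a) :* w) refl b z a 0#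
  evalPoly-differenceQuotient b (c ∷ cs) z a = begin
    (b + z * u) - (b + a * v)          ≈⟨ solve 5 (λ b z a u v → (b :+ z :* u) :- (b :+ a :* v)
                                                   := z :* (u :- v) :+ (z :- a) :* v) refl b z a u v ⟩
    z * (u - v) + (z - a) * v          ≈⟨ +-congʳ (*-congˡ (evalPoly-differenceQuotient c cs z a)) ⟩
    z * ((z - a) * w) + (z - a) * v    ≈⟨ solve 4 (λ z a v w → z :* ((z :- a) :* w) :+ (z :- a) :* v
                                                   := (z :- a) :* (v :+ z :* w)) refl z a v w ⟩
    (z - a) * (v + z * w)              ∎
    where
    u = evalPoly F (c ∷ cs) z
    v = evalPoly F (c ∷ cs) a
    w = evalPoly F (differenceQuotient a cs) z

  constantTerm≈0 : ∀ {c cs} a → All (_≈ 0#) cs → evalPoly F (c ∷ cs) a ≈ 0# → c ≈ 0#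
  constantTerm≈0 {c} {cs} a cs≈0 ca≈0 = begin
    c                            ≈⟨ +-identityʳ c ⟨
    c + 0#                       ≈⟨ +-congˡ (zeroʳ a) ⟨
    c + a * 0#                   ≈⟨ +-congˡ (*-congˡ (evalPoly-zeros a cs≈0)) ⟨
    c + a * evalPoly F cs a      ≈⟨ ca≈0 ⟩
    0#                           ∎

  differenceQuotient-zeros : ∀ a cs → All (_≈ 0#) (differenceQuotient a cs) → All (_≈ 0#) cs
  differenceQuotient-zeros a []       _           = []
  differenceQuotient-zeros a (c ∷ cs) (v≈0 ∷ q≈0) = constantTerm≈0 a cs≈0 v≈0 ∷ cs≈0
    where cs≈0 = differenceQuotient-zeros a cs q≈0

  linearTimesPlus : Carrier → Carrier → List Carrier → List Carrier
  linearTimesPlus a c []       = c - a ∷ []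
  linearTimesPlus a c (d ∷ ds) = c - a * d ∷ linearTimesPlus a d ds

  evalMonicList-linearTimesPlus : ∀ a c cs x →
    evalMonicList (linearTimesPlus a c cs) x ≈ (x - a) * evalMonicList cs x + c
  evalMonicList-linearTimesPlus a c [] x = begin
    (c - a) + x * 1#       ≈⟨ +-congˡ (*-identityʳ x) ⟩
    (c - a) + x            ≈⟨ solve 3 (λ a c x → (c :- a) :+ x := (x :- a) :+ c) refl a c x ⟩
    (x - a) + c            ≈⟨ +-congʳ (*-identityʳ _) ⟨
    (x - a) * 1# + c       ∎
  evalMonicList-linearTimesPlus a c (d ∷ ds) x = begin
    (c - a * d) + x * evalMonicList (linearTimesPlus a d ds) x
      ≈⟨ +-congˡ (*-congˡ (evalMonicList-linearTimesPlus a d ds x)) ⟩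
    (c - a * d) + x * ((x - a) * M + d)
      ≈⟨ solve 5 (λ a c d x M → (c :- a :* d) :+ x :* ((x :- a) :* M :+ d)
                                := (x :- a) :* (d :+ x :* M) :+ c) refl a c d x M ⟩
    (x - a) * (d + x * M) + c ∎
    where M = evalMonicList ds x

  vanishingOn : List Carrier → List Carrier
  vanishingOn []      = []
  vanishingOn (a ∷ l) = linearTimesPlus a 0# (vanishingOn l)

  vanishingOn-root : ∀ {y} l → Any (y ≈_) l → evalMonicList (vanishingOn l) y ≈ 0#
  vanishingOn-root {y} (a ∷ l) y∈a∷l = begin
    evalMonicList (linearTimesPlus a 0# (vanishingOn l)) y   ≈⟨ evalMonicList-linearTimesPlus a 0# (vanishingOn l) y ⟩
    (y - a) * evalMonicList (vanishingOn l) y + 0#           ≈⟨ +-identityʳ _ ⟩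
    (y - a) * evalMonicList (vanishingOn l) y                ≈⟨ product≈0 y∈a∷l ⟩
    0#                                                       ∎
    where
    product≈0 : Any (y ≈_) (a ∷ l) → (y - a) * evalMonicList (vanishingOn l) y ≈ 0#
    product≈0 (here y≈a)  = trans (*-congʳ (x≈y⇒x∙y⁻¹≈ε y≈a)) (zeroˡ _)
    product≈0 (there y∈l) = trans (*-congˡ (vanishingOn-root l y∈l)) (zeroʳ _)

  module _ (isField : IsField F) (closed : AlgebraicallyClosed) where
    open IsField isField
    open import Data.Product using (_×_)

    *-cancelˡ-≈0 : ∀ {d u} → d ≉ 0# → d * u ≈ 0# → u ≈ 0#
    *-cancelˡ-≈0 {d} {u} d≉0 du≈0 with inverse d d≉0
    ... | d⁻¹ , dd⁻¹≈1 = begin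
      u                ≈⟨ *-identityˡ u ⟨
      1# * u           ≈⟨ *-congʳ dd⁻¹≈1 ⟨
      (d * d⁻¹) * u    ≈⟨ xy∙z≈y∙xz d d⁻¹ u ⟩
      d⁻¹ * (d * u)    ≈⟨ *-congˡ du≈0 ⟩
      d⁻¹ * 0#         ≈⟨ zeroʳ d⁻¹ ⟩
      0#               ∎
      where open import Algebra.Properties.CommutativeSemigroup *-commutativeSemigroup using (xy∙z≈y∙xz)

    -- a root of 1 + x·∏_{a ∈ l} (x - a) lies outside l
    fresh : ∀ l → Σ Carrier (λ y → All (y ≉_) l)
    fresh l with rootOfMonic closed 1# (vanishingOn l)
    ... | y , root = y , ¬Any⇒All¬ l (λ y∈l → nontrivial (begin
      1#                                       ≈⟨ +-identityʳ 1# ⟨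
      1# + 0#                                  ≈⟨ +-congˡ (zeroʳ y) ⟨
      1# + y * 0#                              ≈⟨ +-congˡ (*-congˡ (vanishingOn-root l y∈l)) ⟨
      1# + y * evalMonicList (vanishingOn l) y ≈⟨ root ⟩
      0#                                       ∎))

    distinctPoints : ∀ n → Σ (List Carrier) (λ l → length l ≡ n × AllPairs _≉_ l)
    distinctPoints zero = [] , ≡.refl , []
    distinctPoints (suc n) with distinctPoints n
    ... | l , ≡.refl , distinct with fresh l
    ...   | y , y∉l = y ∷ l , ≡.refl , y∉l ∷ distinct

    vanishesOn⇒zeros : ∀ P {pts} → length P ≤ length pts → AllPairs _≉_ pts →
                       All (λ a → evalPoly F P a ≈ 0#) pts → All (_≈ 0#) P
    vanishesOn⇒zeros []       _ _ _ = []
    vanishesOn⇒zeros (b ∷ bs) {a ∷ as} (s≤s len≤) (a∉as ∷ distinct) (Pa≈0 ∷ Pas≈0) =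
      constantTerm≈0 a bs≈0 Pa≈0 ∷ bs≈0
      where
      Q = differenceQuotient a bs

      Q-vanishes : ∀ {z} → a ≉ z × evalPoly F (b ∷ bs) z ≈ 0# → evalPoly F Q z ≈ 0#
      Q-vanishes {z} (a≉z , Pz≈0) = *-cancelˡ-≈0 (a≉z ∘ sym ∘ x∙y⁻¹≈ε⇒x≈y z a) (begin
        (z - a) * evalPoly F Q z                          ≈⟨ evalPoly-differenceQuotient b bs z a ⟨
        evalPoly F (b ∷ bs) z - evalPoly F (b ∷ bs) a     ≈⟨ +-cong Pz≈0 (-‿cong Pa≈0) ⟩
        0# - 0#                                           ≈⟨ -‿inverseʳ 0# ⟩
        0#                                                ∎)

      bs≈0 : All (_≈ 0#) bs
      bs≈0 = differenceQuotient-zeros a bs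
        (vanishesOn⇒zeros Q (≡.subst (_≤ length as) (≡.sym (length-differenceQuotient a bs)) len≤)
          distinct (All.zipWith Q-vanishes (a∉as , Pas≈0)))

    vanishing⇒zeros : ∀ P → (∀ x → evalPoly F P x ≈ 0#) → All (_≈ 0#) P
    vanishing⇒zeros P P≈0 with distinctPoints (length P)
    ... | pts , len≡ , distinct =
      vanishesOn⇒zeros P (ℕ.≤-reflexive (≡.sym len≡)) distinct (All.universal P≈0 pts)

    coeff-unique : ∀ P Q → (∀ x → evalPoly F P x ≈ evalPoly F Q x) → ∀ n → coeff P n ≈ coeff Q n
    coeff-unique P Q P≈Q n = x∙y⁻¹≈ε⇒x≈y _ _ (begin
      coeff P n - coeff Q n               ≈⟨ +-congˡ (coeff-map -_ -0#≈0# Q n) ⟨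
      coeff P n + coeff (map -_ Q) n      ≈⟨ coeff-⊕ P (map -_ Q) n ⟨
      coeff (P ⊕ map -_ Q) n              ≈⟨ coeff-All refl (vanishing⇒zeros (P ⊕ map -_ Q) difference≈0) n ⟩
      0#                                  ∎)
      where
      difference≈0 : ∀ x → evalPoly F (P ⊕ map -_ Q) x ≈ 0#
      difference≈0 x = begin
        evalPoly F (P ⊕ map -_ Q) x                  ≈⟨ evalPoly-⊕ P (map -_ Q) x ⟩
        evalPoly F P x + evalPoly F (map -_ Q) x     ≈⟨ +-cong (P≈Q x) (evalPoly-neg Q x) ⟩
        evalPoly F Q x - evalPoly F Q x              ≈⟨ -‿inverseʳ _ ⟩
        0#                                           ∎

  -- Frobenius in characteristic p

  module _ {p} (p-prime : Prime p) (char-p : natF F p ≈ 0#) where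
    open import Algebra.Properties.Semiring.Mult semiring using (_×_; ×-congʳ; ×-assoc-*; ×1-homo-*; ×-homo-1)
    import Algebra.Properties.CommutativeSemiring.Binomial commutativeSemiring as Binomial

    private instance
      p≢0 : ℕ.NonZero p
      p≢0 = prime⇒nonZero p-prime

    natF≡×1# : ∀ n → natF F n ≡ n × 1#
    natF≡×1# zero    = ≡.refl
    natF≡×1# (suc n) = ≡.cong (1# +_) (natF≡×1# n)

    multiple×≈0 : ∀ {m} x → p ∣ m → m × x ≈ 0#
    multiple×≈0 {m} x (divides t m≡t*p) = begin
      m × x                          ≈⟨ ×-congʳ m (*-identityˡ x) ⟨
      m × (1# * x)                   ≈⟨ ×-assoc-* m 1# x ⟨
      (m × 1#) * x                   ≡⟨ ≡.cong (λ k → (k × 1#) * x) m≡t*p ⟩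
      ((t ℕ.* p) × 1#) * x           ≈⟨ *-congʳ (×1-homo-* t p) ⟩
      ((t × 1#) * (p × 1#)) * x      ≡⟨ ≡.cong (λ y → ((t × 1#) * y) * x) (natF≡×1# p) ⟨
      ((t × 1#) * natF F p) * x      ≈⟨ *-congʳ (trans (*-congˡ char-p) (zeroʳ _)) ⟩
      0# * x                         ≈⟨ zeroˡ x ⟩
      0#                             ∎

    frobenius-+ : ∀ x y → (x + y) ^ᴿ p ≈ x ^ᴿ p + y ^ᴿ p
    frobenius-+ x y = begin
      (x + y) ^ᴿ p                        ≡⟨ ^ᴿ≡^ (x + y) p ⟩
      (x + y) ^ˢ p                        ≈⟨ Binomial.theorem p x y ⟩
      Binomial.binomialExpansion x y p    ≡⟨ sum≡sumBelow (suc p) term ⟩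
      sumBelow (suc p) term               ≈⟨ sumBelow-ends p term (ℕ.>-nonZero⁻¹ p) interior≈0 ⟩
      term 0 + term p                     ≈⟨ +-cong term₀ termₚ ⟩
      y ^ᴿ p + x ^ᴿ p                     ≈⟨ +-comm _ _ ⟩
      x ^ᴿ p + y ^ᴿ p                     ∎
      where
      term : ℕ → Carrier
      term k = (p C k) × (x ^ˢ k * y ^ˢ (p ∸ k))
      interior≈0 : ∀ k → 0 < k → k < p → term k ≈ 0#
      interior≈0 k 0<k k<p = multiple×≈0 _ (prime∣binomial p-prime 0<k k<p)
      term₀ : term 0 ≈ y ^ᴿ p
      term₀ = trans (×-homo-1 _) (trans (*-identityˡ _) (reflexive (≡.sym (^ᴿ≡^ y p))))
      termₚ : term p ≈ x ^ᴿ p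
      termₚ = begin
        term p               ≡⟨ ≡.cong₂ (λ k l → k × (x ^ˢ p * y ^ˢ l)) (nCn≡1 p) (ℕ.n∸n≡0 p) ⟩
        1 × (x ^ˢ p * 1#)    ≈⟨ trans (×-homo-1 _) (*-identityʳ _) ⟩
        x ^ˢ p               ≡⟨ ^ᴿ≡^ x p ⟨
        x ^ᴿ p               ∎

    frobenius-+-iter : ∀ k x y → (x + y) ^ᴿ (p ^ k) ≈ x ^ᴿ (p ^ k) + y ^ᴿ (p ^ k)
    frobenius-+-iter zero    x y = trans (x^ᴿ1≈x _) (sym (+-cong (x^ᴿ1≈x x) (x^ᴿ1≈x y)))
    frobenius-+-iter (suc k) x y = begin
      (x + y) ^ᴿ (p ^ suc k)                        ≈⟨ ^ᴿ-^-suc (x + y) p k ⟨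
      ((x + y) ^ᴿ (p ^ k)) ^ᴿ p                     ≈⟨ ^ᴿ-congˡ p (frobenius-+-iter k x y) ⟩
      (x ^ᴿ (p ^ k) + y ^ᴿ (p ^ k)) ^ᴿ p            ≈⟨ frobenius-+ _ _ ⟩
      (x ^ᴿ (p ^ k)) ^ᴿ p + (y ^ᴿ (p ^ k)) ^ᴿ p     ≈⟨ +-cong (^ᴿ-^-suc x p k) (^ᴿ-^-suc y p k) ⟩
      x ^ᴿ (p ^ suc k) + y ^ᴿ (p ^ suc k)           ∎

    frobenius-sumBelow : ∀ n f → sumBelow n f ^ᴿ p ≈ sumBelow n (λ i → f i ^ᴿ p)
    frobenius-sumBelow zero    f = 0^ᴿn≈0 p
    frobenius-sumBelow (suc n) f = trans (frobenius-+ _ _) (+-congˡ (frobenius-sumBelow n (f ∘ suc)))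

    frobenius-evalPoly : ∀ bs x → evalPoly F bs x ^ᴿ p ≈ evalPoly F (map (_^ᴿ p) bs) (x ^ᴿ p)
    frobenius-evalPoly []       x = 0^ᴿn≈0 p
    frobenius-evalPoly (b ∷ bs) x = begin
      (b + x * evalPoly F bs x) ^ᴿ p                         ≈⟨ frobenius-+ b _ ⟩
      b ^ᴿ p + (x * evalPoly F bs x) ^ᴿ p                    ≈⟨ +-congˡ (^ᴿ-distrib-* x _ p) ⟩
      b ^ᴿ p + x ^ᴿ p * evalPoly F bs x ^ᴿ p                 ≈⟨ +-congˡ (*-congˡ (frobenius-evalPoly bs x)) ⟩
      b ^ᴿ p + x ^ᴿ p * evalPoly F (map (_^ᴿ p) bs) (x ^ᴿ p) ∎

    -- The polynomial R and the curve C_R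

    module _ {e} (as : Vec Carrier (suc e)) where

      coeffR : ℕ → Carrier
      coeffR = coeff (Vec.toList as)

      coeffR-beyond : ∀ {k} → suc e ≤ k → coeffR k ≡ 0#
      coeffR-beyond e<k = coeff-beyond (Vec.toList as) (≡.subst (_≤ _) (≡.sym (length-toList as)) e<k)

      R : Carrier → Carrier
      R = evalR F p e as

      ΣFin-lookup≈sumBelow : ∀ (h : Carrier → ℕ → Carrier) →
        ΣFin F (suc e) (λ i → h (lookup as i) (toℕ i)) ≈ sumBelow (suc e) (λ i → h (coeffR i) i)
      ΣFin-lookup≈sumBelow h = trans
        (ΣFin-cong (suc e) (λ i → reflexive (≡.cong (λ α → h α (toℕ i)) (lookup≡coeff as i))))
        (reflexive (ΣFin≡sumBelow (suc e) (λ i → h (coeffR i) i)))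

      Rterm : Carrier → ℕ → Carrier
      Rterm x i = coeffR i * x ^ᴿ (p ^ i)

      R≈sumBelow : ∀ x → R x ≈ sumBelow (suc e) (Rterm x)
      R≈sumBelow x = ΣFin-lookup≈sumBelow (λ α k → α * x ^ᴿ (p ^ k))

      Eterm : Carrier → ℕ → ℕ → Carrier
      Eterm x j i = (coeffR i * x) ^ᴿ (p ^ (j ∸ i))

      evalE≈sumBelow : ∀ x → evalE F p e as x ≈ R x ^ᴿ (p ^ e) + sumBelow (suc e) (Eterm x e)
      evalE≈sumBelow x = +-congˡ (ΣFin-lookup≈sumBelow (λ α k → (α * x) ^ᴿ (p ^ (e ∸ k))))

      R-+ : ∀ x y → R (x + y) ≈ R x + R y
      R-+ x y = begin
        R (x + y)                                               ≈⟨ R≈sumBelow (x + y) ⟩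
        sumBelow (suc e) (Rterm (x + y))                        ≈⟨ sumBelow-cong (suc e) _ RₓRᵧ Rterm-+ ⟩
        sumBelow (suc e) RₓRᵧ                                   ≈⟨ sumBelow-distrib-+ (suc e) (Rterm x) (Rterm y) ⟩
        sumBelow (suc e) (Rterm x) + sumBelow (suc e) (Rterm y) ≈⟨ +-cong (R≈sumBelow x) (R≈sumBelow y) ⟨
        R x + R y                                               ∎
        where
        RₓRᵧ : ℕ → Carrier
        RₓRᵧ i = Rterm x i + Rterm y i
        Rterm-+ : ∀ i → i < suc e → Rterm (x + y) i ≈ RₓRᵧ i
        Rterm-+ i _ = trans (*-congˡ (frobenius-+-iter i x y)) (distribˡ _ _ _)

      cRMonomial : Carrier → ℕ → List Carrier
      cRMonomial c i = monomial (p ^ i) (coeffR i * c)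

      cRPoly : Carrier → List Carrier
      cRPoly c = sumᴾ (suc e) (cRMonomial c)

      evalPoly-cRPoly : ∀ c x → evalPoly F (cRPoly c) x ≈ c * R x
      evalPoly-cRPoly c x = begin
        evalPoly F (cRPoly c) x                     ≈⟨ evalPoly-sumᴾ (suc e) (cRMonomial c) x ⟩
        sumBelow (suc e) monomialTerm               ≈⟨ sumBelow-cong (suc e) _ _ monomialTerm≈ ⟩
        sumBelow (suc e) (λ i → c * Rterm x i)      ≈⟨ *-distribˡ-sumBelow (suc e) c (Rterm x) ⟩
        c * sumBelow (suc e) (Rterm x)              ≈⟨ *-congˡ (R≈sumBelow x) ⟨
        c * R x                                     ∎
        where
        monomialTerm : ℕ → Carrier
        monomialTerm i = evalPoly F (cRMonomial c i) x
        monomialTerm≈ : ∀ i → i < suc e → monomialTerm i ≈ c * Rterm x i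
        monomialTerm≈ i _ = begin
          monomialTerm i                  ≈⟨ evalPoly-monomial (p ^ i) _ x ⟩
          (coeffR i * c) * x ^ᴿ (p ^ i)   ≈⟨ *-congʳ (*-comm _ c) ⟩
          (c * coeffR i) * x ^ᴿ (p ^ i)   ≈⟨ *-assoc c _ _ ⟩
          c * Rterm x i                   ∎

      coeff-cRPoly : ∀ c k → coeff (cRPoly c) (p ^ k) ≈ coeffR k * c
      coeff-cRPoly c k = trans (coeff-sumᴾ (suc e) (cRMonomial c) (p ^ k)) (onlyTerm (k ℕ.<? suc e))
        where
        term : ℕ → Carrier
        term i = coeff (cRMonomial c i) (p ^ k)
        term≈0 : ∀ {i} → i ≢ k → term i ≈ 0#
        term≈0 {i} i≢k =
          coeff-monomial-≢ (p ^ i) (coeffR i * c) (i≢k ∘ ≡.sym ∘ ^-injectiveʳ (prime⇒2≤ p-prime))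
        onlyTerm : Dec (k < suc e) → sumBelow (suc e) term ≈ coeffR k * c
        onlyTerm (yes k≤e) =
          trans (sumBelow-single (suc e) k term k≤e (λ i _ → term≈0 {i}))
                (reflexive (coeff-monomial-≡ (p ^ k) (coeffR k * c)))
        onlyTerm (no k≰e) = begin
          sumBelow (suc e) term   ≈⟨ sumBelow-zero (suc e) term (λ i i≤e → term≈0 {i} (λ { ≡.refl → k≰e i≤e })) ⟩
          0#                      ≈⟨ zeroˡ c ⟨
          0# * c                  ≡⟨ ≡.cong (_* c) (coeffR-beyond (ℕ.≮⇒≥ k≰e)) ⟨
          coeffR k * c            ∎

      module _ (isField : IsField F) (closed : AlgebraicallyClosed) (g : List Carrier) (c : Carrier)
               (maps-into : ∀ a x → OnC F p e as a x → OnC F p e as (a + evalPoly F g x) (x + c)) where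

        G : Carrier → Carrier
        G = evalPoly F g

        -- a root of yᵖ - y - x R(x)
        pointOver : ∀ x → Σ Carrier (λ a → OnC F p e as a x)
        pointOver x with rootOfMonic closed (- (x * R x)) (- 1# ∷ replicate (p ∸ 2) 0#)
        ... | y , root = y , (begin
          y ^ᴿ p - y                         ≡⟨ ≡.cong (λ k → y ^ᴿ k - y) (ℕ.m+[n∸m]≡n (prime⇒2≤ p-prime)) ⟨
          y * (y * y ^ᴿ (p ∸ 2)) - y         ≈⟨ +-congʳ (*-congˡ (*-congˡ (evalMonicList-zeros (p ∸ 2) y))) ⟨
          y * Z - y                          ≈⟨ solve 3 (λ X y Z → y :* Z :- y := X :+ (:- X :+ (y :* Z :- y)))
                                                         refl X y Z ⟩
          X + (- X + (y * Z - y))            ≈⟨ +-congˡ (+-congˡ (y[-1+z]≈yz-y y Z)) ⟨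
          X + (- X + y * (- 1# + Z))         ≈⟨ +-congˡ root ⟩
          X + 0#                             ≈⟨ +-identityʳ X ⟩
          X                                  ∎)
          where
          X = x * R x
          Z = y * evalMonicList (replicate (p ∸ 2) 0#) y
          y[-1+z]≈yz-y : ∀ y z → y * (- 1# + z) ≈ y * z - y
          y[-1+z]≈yz-y y z = begin
            y * (- 1# + z)       ≈⟨ distribˡ y (- 1#) z ⟩
            y * - 1# + y * z     ≈⟨ +-congʳ (-‿distribʳ-* y 1#) ⟨
            - (y * 1#) + y * z   ≈⟨ +-congʳ (-‿cong (*-identityʳ y)) ⟩
            - y + y * z          ≈⟨ +-comm (- y) _ ⟩
            y * z - y            ∎

        Gᵖ-identity : ∀ x → G x ^ᴿ p ≈ G x + (c * R c + x * R c) + c * R x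
        Gᵖ-identity x = begin
          G x ^ᴿ p
            ≈⟨ solve 4 (λ A B a G → B := ((A :+ B) :- (a :+ G)) :- (A :- a) :+ G)
                       refl (a ^ᴿ p) (G x ^ᴿ p) a (G x) ⟩
          ((a ^ᴿ p + G x ^ᴿ p) - (a + G x)) - (a ^ᴿ p - a) + G x
            ≈⟨ +-congʳ (+-congʳ (+-congʳ (frobenius-+ a (G x)))) ⟨
          ((a + G x) ^ᴿ p - (a + G x)) - (a ^ᴿ p - a) + G x
            ≈⟨ +-congʳ (+-cong (maps-into a x onC) (-‿cong onC)) ⟩
          (x + c) * R (x + c) - x * R x + G x
            ≈⟨ +-congʳ (+-congʳ (*-congˡ (R-+ x c))) ⟩
          (x + c) * (R x + R c) - x * R x + G x
            ≈⟨ solve 5 (λ x c Rx Rc G → (x :+ c) :* (Rx :+ Rc) :- x :* Rx :+ G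
                                          := G :+ (c :* Rc :+ x :* Rc) :+ c :* Rx) refl x c (R x) (R c) (G x) ⟩
          G x + (c * R c + x * R c) + c * R x ∎
          where
          a = proj₁ (pointOver x)
          onC = proj₂ (pointOver x)

        Gᵖ-poly : List Carrier
        Gᵖ-poly = spread p (map (_^ᴿ p) g)

        linearPart : List Carrier
        linearPart = c * R c ∷ R c ∷ []

        rhs-poly : List Carrier
        rhs-poly = g ⊕ linearPart ⊕ cRPoly c

        Gᵖ-poly≈rhs-poly : ∀ x → evalPoly F Gᵖ-poly x ≈ evalPoly F rhs-poly x
        Gᵖ-poly≈rhs-poly x = begin
          evalPoly F Gᵖ-poly x                                     ≈⟨ evalPoly-spread p (map (_^ᴿ p) g) x ⟩
          evalPoly F (map (_^ᴿ p) g) (x ^ᴿ p)                      ≈⟨ frobenius-evalPoly g x ⟨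
          G x ^ᴿ p                                                 ≈⟨ Gᵖ-identity x ⟩
          G x + (c * R c + x * R c) + c * R x                      ≈⟨ +-cong (+-congˡ linear) (evalPoly-cRPoly c x) ⟨
          G x + evalPoly F linearPart x + evalPoly F (cRPoly c) x  ≈⟨ +-congʳ (evalPoly-⊕ g linearPart x) ⟨
          evalPoly F (g ⊕ linearPart) x + evalPoly F (cRPoly c) x  ≈⟨ evalPoly-⊕ (g ⊕ linearPart) (cRPoly c) x ⟨
          evalPoly F rhs-poly x                                    ∎
          where
          linear : evalPoly F linearPart x ≈ c * R c + x * R c
          linear = +-congˡ (*-congˡ (trans (+-congˡ (zeroʳ x)) (+-identityʳ (R c))))

        coeff-Gᵖ-poly≈coeff-rhs-poly : ∀ n → coeff Gᵖ-poly n ≈ coeff rhs-poly n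
        coeff-Gᵖ-poly≈coeff-rhs-poly = coeff-unique isField closed Gᵖ-poly rhs-poly Gᵖ-poly≈rhs-poly

        coeff-rhs-poly : ∀ n → coeff rhs-poly n ≈ coeff g n + coeff linearPart n + coeff (cRPoly c) n
        coeff-rhs-poly n = trans (coeff-⊕ (g ⊕ linearPart) (cRPoly c) n) (+-congʳ (coeff-⊕ g linearPart n))

        t : ℕ → Carrier
        t j = coeff g (p ^ j)

        t₀-equation : t 0 + (R c + coeffR 0 * c) ≈ 0#
        t₀-equation = begin
          t 0 + (R c + coeffR 0 * c)           ≈⟨ +-assoc _ _ _ ⟨
          t 0 + R c + coeffR 0 * c             ≈⟨ +-congˡ (coeff-cRPoly c 0) ⟨
          t 0 + R c + coeff (cRPoly c) 1       ≈⟨ coeff-rhs-poly 1 ⟨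
          coeff rhs-poly 1                     ≈⟨ coeff-Gᵖ-poly≈coeff-rhs-poly 1 ⟨
          coeff Gᵖ-poly 1                      ≡⟨ coeff-spread-1 p (map (_^ᴿ p) g) (prime⇒2≤ p-prime) ⟩
          0#                                   ∎

        t-recursion : ∀ j → t j ^ᴿ p ≈ t (suc j) + coeffR (suc j) * c
        t-recursion j = begin
          t j ^ᴿ p                                    ≈⟨ coeff-map (_^ᴿ p) (0^ᴿn≈0 p) g (p ^ j) ⟨
          coeff (map (_^ᴿ p) g) (p ^ j)               ≡⟨ coeff-spread p (map (_^ᴿ p) g) (p ^ j) ⟨
          coeff Gᵖ-poly (p ^ j ℕ.* p)                 ≡⟨ ≡.cong (coeff Gᵖ-poly) (ℕ.*-comm (p ^ j) p) ⟩
          coeff Gᵖ-poly (p ^ suc j)                   ≈⟨ coeff-Gᵖ-poly≈coeff-rhs-poly (p ^ suc j) ⟩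
          coeff rhs-poly (p ^ suc j)                  ≈⟨ coeff-rhs-poly (p ^ suc j) ⟩
          t (suc j) + coeff linearPart (p ^ suc j) + coeff (cRPoly c) (p ^ suc j)
                                                      ≈⟨ +-cong (+-congˡ (reflexive (coeff-beyond linearPart 2≤p^[1+j])))
                                                                (coeff-cRPoly c (suc j)) ⟩
          t (suc j) + 0# + coeffR (suc j) * c         ≈⟨ +-congʳ (+-identityʳ _) ⟩
          t (suc j) + coeffR (suc j) * c              ∎
          where
          2≤p^[1+j] : 2 ≤ p ^ suc j
          2≤p^[1+j] = ℕ.^-monoʳ-< p (prime⇒2≤ p-prime) (s≤s (z≤n {j}))

        W : ℕ → Carrier
        W zero    = R c + coeffR 0 * c
        W (suc j) = W j ^ᴿ p + coeffR (suc j) * c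

        t+W≈0 : ∀ j → t j + W j ≈ 0#
        t+W≈0 zero    = t₀-equation
        t+W≈0 (suc j) = begin
          t (suc j) + (W j ^ᴿ p + coeffR (suc j) * c)    ≈⟨ x∙yz≈xz∙y _ _ _ ⟩
          (t (suc j) + coeffR (suc j) * c) + W j ^ᴿ p    ≈⟨ +-congʳ (t-recursion j) ⟨
          t j ^ᴿ p + W j ^ᴿ p                            ≈⟨ frobenius-+ (t j) (W j) ⟨
          (t j + W j) ^ᴿ p                               ≈⟨ ^ᴿ-congˡ p (t+W≈0 j) ⟩
          0# ^ᴿ p                                        ≈⟨ 0^ᴿn≈0 p ⟩
          0#                                             ∎
          where open import Algebra.Properties.CommutativeSemigroup +-commutativeSemigroup using (x∙yz≈xz∙y)

        W≈ : ∀ j → W j ≈ R c ^ᴿ (p ^ j) + sumBelow (suc j) (Eterm c j)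
        W≈ zero    = sym (+-cong (x^ᴿ1≈x (R c)) (trans (+-identityʳ _) (x^ᴿ1≈x _)))
        W≈ (suc j) = begin
          W j ^ᴿ p + coeffR (suc j) * c
            ≈⟨ +-congʳ (^ᴿ-congˡ p (W≈ j)) ⟩
          (R c ^ᴿ (p ^ j) + sumBelow (suc j) (Eterm c j)) ^ᴿ p + coeffR (suc j) * c
            ≈⟨ +-congʳ (trans (frobenius-+ _ _)
                              (+-cong (^ᴿ-^-suc (R c) p j) (frobenius-sumBelow (suc j) (Eterm c j)))) ⟩
          (R c ^ᴿ (p ^ suc j) + sumBelow (suc j) (λ i → Eterm c j i ^ᴿ p)) + coeffR (suc j) * c
            ≈⟨ +-congʳ (+-congˡ (sumBelow-cong (suc j) _ (Eterm c (suc j)) Eterm-step)) ⟩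
          (R c ^ᴿ (p ^ suc j) + sumBelow (suc j) (Eterm c (suc j))) + coeffR (suc j) * c
            ≈⟨ +-assoc _ _ _ ⟩
          R c ^ᴿ (p ^ suc j) + (sumBelow (suc j) (Eterm c (suc j)) + coeffR (suc j) * c)
            ≈⟨ +-congˡ (+-congˡ Eterm-last) ⟩
          R c ^ᴿ (p ^ suc j) + (sumBelow (suc j) (Eterm c (suc j)) + Eterm c (suc j) (suc j))
            ≈⟨ +-congˡ (sumBelow-last (suc j) (Eterm c (suc j))) ⟨
          R c ^ᴿ (p ^ suc j) + sumBelow (suc (suc j)) (Eterm c (suc j)) ∎
          where
          Eterm-step : ∀ i → i < suc j → Eterm c j i ^ᴿ p ≈ Eterm c (suc j) i
          Eterm-step i i≤j = trans (^ᴿ-^-suc _ p (j ∸ i))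
            (reflexive (≡.cong (λ k → (coeffR i * c) ^ᴿ (p ^ k)) (≡.sym (ℕ.+-∸-assoc 1 (ℕ.m<1+n⇒m≤n i≤j)))))
          Eterm-last : coeffR (suc j) * c ≈ Eterm c (suc j) (suc j)
          Eterm-last = sym (trans (reflexive (≡.cong (λ k → (coeffR (suc j) * c) ^ᴿ (p ^ k)) (ℕ.n∸n≡0 j)))
                                  (x^ᴿ1≈x _))

        t-frobenius-beyond-e : ∀ n → t (n ℕ.+ e) ≈ t e ^ᴿ (p ^ n)
        t-frobenius-beyond-e zero    = sym (x^ᴿ1≈x (t e))
        t-frobenius-beyond-e (suc n) = begin
          t (suc n ℕ.+ e)                                ≈⟨ +-identityʳ _ ⟨
          t (suc n ℕ.+ e) + 0#                           ≈⟨ +-congˡ (trans (*-congʳ (reflexive a≡0)) (zeroˡ c)) ⟨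
          t (suc n ℕ.+ e) + coeffR (suc n ℕ.+ e) * c     ≈⟨ t-recursion (n ℕ.+ e) ⟨
          t (n ℕ.+ e) ^ᴿ p                               ≈⟨ ^ᴿ-congˡ p (t-frobenius-beyond-e n) ⟩
          (t e ^ᴿ (p ^ n)) ^ᴿ p                          ≈⟨ ^ᴿ-^-suc (t e) p n ⟩
          t e ^ᴿ (p ^ suc n)                             ∎
          where
          a≡0 : coeffR (suc n ℕ.+ e) ≡ 0#
          a≡0 = coeffR-beyond (s≤s (ℕ.m≤n+m e n))

        module _ (f : ℕ) (g∈Fq : All (InFq F (p ^ suc f)) g) where

          tₑ≈0 : t e ≈ 0#
          tₑ≈0 = begin
            t e                           ≈⟨ ^ᴿ-fixed-iter tₑ∈Fq K ⟨
            t e ^ᴿ (p ^ suc f) ^ K        ≡⟨ ≡.cong (t e ^ᴿ_) (ℕ.^-*-assoc p (suc f) K) ⟩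
            t e ^ᴿ (p ^ N)                ≈⟨ t-frobenius-beyond-e N ⟨
            t (N ℕ.+ e)                   ≡⟨ coeff-beyond g K≤p^[N+e] ⟩
            0#                            ∎
            where
            K = length g
            N = suc f ℕ.* K
            instance _ = ℕ.m^n≢0 p (suc f)
            tₑ∈Fq : InFq F (p ^ suc f) (t e)
            tₑ∈Fq = coeff-All (0^ᴿn≈0 (p ^ suc f)) g∈Fq (p ^ e)
            K≤p^[N+e] : K ≤ p ^ (N ℕ.+ e)
            K≤p^[N+e] = ℕ.≤-trans (ℕ.m≤n*m K (suc f))
                          (ℕ.≤-trans (ℕ.m≤m+n N e) (ℕ.<⇒≤ (n<m^n (prime⇒2≤ p-prime) (N ℕ.+ e))))

          E≈0 : evalE F p e as c ≈ 0#
          E≈0 = begin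
            evalE F p e as c                                  ≈⟨ evalE≈sumBelow c ⟩
            R c ^ᴿ (p ^ e) + sumBelow (suc e) (Eterm c e)       ≈⟨ W≈ e ⟨
            W e                                               ≈⟨ +-identityˡ (W e) ⟨
            0# + W e                                          ≈⟨ +-congʳ tₑ≈0 ⟨
            t e + W e                                         ≈⟨ t+W≈0 e ⟩
            0#                                                ∎

-- Not needed: p ≠ 2, aᵢ ∈ F_q, aₑ ≠ 0, algebraicity of F over F_q, and surjectivity of the automorphism.
lemma4p1 : {c ℓ : Level} (F : CommutativeRing c ℓ) →
    (p f : ℕ) → Prime p → ¬ (p ≡ 2) →
    IsAlgClosureOfFq F p (p ^ suc f) →
    (e : ℕ) (as : Vec (CommutativeRing.Carrier F) (suc e)) →
    ((i : Fin (suc e)) → InFq F (p ^ suc f) (lookup as i)) →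
    ¬ (CommutativeRing._≈_ F (lookup as (fromℕ e)) (CommutativeRing.0# F)) →
    (g : List (CommutativeRing.Carrier F)) → All (InFq F (p ^ suc f)) g →
    (cc : CommutativeRing.Carrier F) →
    IsCurveAut F p e as g cc →
    CommutativeRing._≈_ F (evalE F p e as cc) (CommutativeRing.0# F)
lemma4p1 F p f p-prime _ closure e as _ _ g g∈Fq c (maps-into , _) =
  E≈0 F p-prime characteristic as isField algClosed g c maps-into f g∈Fq
  where open IsAlgClosureOfFq closure
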